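{- If positive integers $n,g,h$ with $g\ge h$ satisfy $\binom{n}{g}>n^h$ and $g>\sqrt{n(g-h)}$, then $h<88$.
   Context: $\binom{n}{g}$ is the binomial coefficient. -}

module Defs where

-- Let k be whichever of g and n − g is at most n/2.  Then C(n,k) = C(n,g), and
-- n(k − h) ≤ k² still holds because n(g − h) − n(n − g − h) = g² − (n − g)².  Put
-- e = k − h.  Since C(n,k)·k! ≤ nᵏ, the first hypothesis gives k! < nᵉ, and n·e ≤ k²
-- with 2k ≤ n gives 2e ≤ k.  With kᵏ ≤ 4ᵏ·k! (from (1 + 1/k)ᵏ ≤ 4) this yields
-- kᵏ·eᵉ < 4ᵏ·(ne)ᵉ ≤ 4ᵏ·k²ᵉ, i.e. kˣ·eᵉ < 4ˣ·16ᵉ for x = k − 2e.  That is false once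
-- k ≥ 88: either e ≥ 16, or x ≥ 58 and 4ˣ·16ᵉ ≤ 16ˣ.

module Submission where

open import Defs
open import Data.Nat using (ℕ; _*_; _∸_; _^_; _≤_; _<_; _>_)
open import Data.Nat.Combinatorics using (_C_)

open import Data.Bool.Base using (true; false)
open import Data.Nat.Base using (zero; suc; _+_; _!; _≤ᵇ_; z≤n; s≤s; s≤s⁻¹; NonZero; >-nonZero; ⌊_/2⌋; ⌈_/2⌉)
open import Data.Nat.Combinatorics using (_P_; nCk≡nPk/k!; nCk≡nC[n∸k]; k>n⇒nCk≡0)
open import Data.Nat.Combinatorics.Base using (_P′_)
open import Data.Nat.DivMod using (_/_; m/n*n≤m)
open import Data.Nat.Properties
open import Data.Nat.Tactic.RingSolver using (solve-∀)
open import Algebra.Properties.CommutativeSemigroup *-commutativeSemigroup using (interchange; x∙yz≈yx∙z; xy∙z≈xz∙y; xy∙z≈x∙zy)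
open import Relation.Binary.PropositionalEquality using (_≡_; refl; sym; cong; subst; module ≡-Reasoning)
open import Relation.Nullary using (yes; no)

[m*n]^o≡m^o*n^o : ∀ m n o → (m * n) ^ o ≡ m ^ o * n ^ o
[m*n]^o≡m^o*n^o m n zero    = refl
[m*n]^o≡m^o*n^o m n (suc o) = begin
  m * n * (m * n) ^ o      ≡⟨ cong (m * n *_) ([m*n]^o≡m^o*n^o m n o) ⟩
  m * n * (m ^ o * n ^ o)  ≡⟨ interchange m n (m ^ o) (n ^ o) ⟩
  m * m ^ o * (n * n ^ o)  ∎
  where open ≡-Reasoning

n^n≢0 : ∀ n → NonZero (n ^ n)
n^n≢0 zero    = _
n^n≢0 (suc n) = m^n≢0 (suc n) (suc n)

nP′k≤n^k : ∀ n k → n P′ k ≤ n ^ k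
nP′k≤n^k n zero    = ≤-refl
nP′k≤n^k n (suc k) = *-mono-≤ (m∸n≤m n k) (nP′k≤n^k n k)

nPk≤n^k : ∀ n k → n P k ≤ n ^ k
nPk≤n^k n k with k ≤ᵇ n
... | true  = nP′k≤n^k n k
... | false = z≤n

nCk*k!≤n^k : ∀ n k → (n C k) * k ! ≤ n ^ k
nCk*k!≤n^k n k with k ≤? n
... | no  k≰n rewrite k>n⇒nCk≡0 (≰⇒> k≰n) = z≤n
... | yes k≤n = begin
  (n C k) * k !          ≡⟨ cong (_* k !) (nCk≡nPk/k! k≤n) ⟩
  ((n P k) / k !) * k !  ≤⟨ m/n*n≤m (n P k) (k !) ⟩
  n P k                  ≤⟨ nPk≤n^k n k ⟩
  n ^ k                  ∎
  where
    open ≤-Reasoning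
    instance _ = k !≢0

n^h<nCk⇒k!<n^[k∸h] : ∀ {n} h k → 0 < n → n ^ h < n C k → k ! < n ^ (k ∸ h)
n^h<nCk⇒k!<n^[k∸h] {n} h k 0<n n^h<nCk = *-cancelˡ-< (n ^ h) (k !) (n ^ (k ∸ h)) (begin-strict
  n ^ h * k !          <⟨ *-monoˡ-< (k !) n^h<nCk ⟩
  (n C k) * k !        ≤⟨ nCk*k!≤n^k n k ⟩
  n ^ k                ≤⟨ ^-monoʳ-≤ n (m≤n+m∸n k h) ⟩
  n ^ (h + (k ∸ h))    ≡⟨ ^-distribˡ-+-* n h (k ∸ h) ⟩
  n ^ h * n ^ (k ∸ h)  ∎)
  where
    open ≤-Reasoning
    instance
      _ = k !≢0
      _ = >-nonZero 0<n

-- Bernoulli's inequality (1 − 1/(1+c))ʲ ≥ 1 − j/(1+c), cleared of denominators.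
[1+c]^[1+j]≤[1+c]*c^j+j*[1+c]^j : ∀ c j → suc c ^ suc j ≤ suc c * c ^ j + j * suc c ^ j
[1+c]^[1+j]≤[1+c]*c^j+j*[1+c]^j c zero    = m≤m+n (suc c * 1) 0
[1+c]^[1+j]≤[1+c]*c^j+j*[1+c]^j c (suc j) = begin
  s * s ^ suc j                                        ≡⟨⟩
  s ^ suc j + c * s ^ suc j                            ≤⟨ +-monoʳ-≤ (s ^ suc j) (*-monoʳ-≤ c IH) ⟩
  s ^ suc j + c * (s * c ^ j + j * s ^ j)              ≤⟨ m≤m+n _ (j * s ^ j) ⟩
  s ^ suc j + c * (s * c ^ j + j * s ^ j) + j * s ^ j  ≡⟨ regroup c j (c ^ j) (s ^ j) ⟩
  s * (c * c ^ j) + suc j * (s * s ^ j)                ∎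
  where
    open ≤-Reasoning
    s : ℕ
    s = suc c
    IH : s ^ suc j ≤ s * c ^ j + j * s ^ j
    IH = [1+c]^[1+j]≤[1+c]*c^j+j*[1+c]^j c j
    regroup : ∀ c j p q → suc c * q + c * (suc c * p + j * q) + j * q ≡ suc c * (c * p) + suc j * (suc c * q)
    regroup = solve-∀

[1+c]^j≤2*c^j : ∀ c j → 2 * j ≤ suc c → suc c ^ j ≤ 2 * c ^ j
[1+c]^j≤2*c^j c j 2j≤1+c = *-cancelˡ-≤ s (+-cancelʳ-≤ (s * s ^ j) (s * s ^ j) (s * (2 * c ^ j)) (begin
  s * s ^ j + s * s ^ j            ≡⟨ double (s * s ^ j) ⟩
  2 * (s * s ^ j)                  ≤⟨ *-monoʳ-≤ 2 ([1+c]^[1+j]≤[1+c]*c^j+j*[1+c]^j c j) ⟩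
  2 * (s * c ^ j + j * s ^ j)      ≡⟨ regroup s (c ^ j) j (s ^ j) ⟩
  s * (2 * c ^ j) + 2 * j * s ^ j  ≤⟨ +-monoʳ-≤ (s * (2 * c ^ j)) (*-monoˡ-≤ (s ^ j) 2j≤1+c) ⟩
  s * (2 * c ^ j) + s * s ^ j      ∎))
  where
    open ≤-Reasoning
    s : ℕ
    s = suc c
    double : ∀ a → a + a ≡ 2 * a
    double = solve-∀
    regroup : ∀ s p j q → 2 * (s * p + j * q) ≡ s * (2 * p) + 2 * j * q
    regroup = solve-∀

2*⌈n/2⌉≤1+n : ∀ n → 2 * ⌈ n /2⌉ ≤ suc n
2*⌈n/2⌉≤1+n zero          = z≤n
2*⌈n/2⌉≤1+n (suc zero)    = ≤-refl
2*⌈n/2⌉≤1+n (suc (suc n)) = ≤-trans (≤-reflexive (*-suc 2 ⌈ n /2⌉)) (s≤s (s≤s (2*⌈n/2⌉≤1+n n)))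

[1+n]^n≤4*n^n : ∀ n → suc n ^ n ≤ 4 * n ^ n
[1+n]^n≤4*n^n n = begin
  suc n ^ n                ≡⟨ cong (suc n ^_) (sym (⌊n/2⌋+⌈n/2⌉≡n n)) ⟩
  suc n ^ (a + b)          ≡⟨ ^-distribˡ-+-* (suc n) a b ⟩
  suc n ^ a * suc n ^ b    ≤⟨ *-mono-≤ ([1+c]^j≤2*c^j n a 2a≤1+n) ([1+c]^j≤2*c^j n b 2b≤1+n) ⟩
  2 * n ^ a * (2 * n ^ b)  ≡⟨ interchange 2 (n ^ a) 2 (n ^ b) ⟩
  4 * (n ^ a * n ^ b)      ≡⟨ cong (4 *_) (^-distribˡ-+-* n a b) ⟨
  4 * n ^ (a + b)          ≡⟨ cong (λ m → 4 * n ^ m) (⌊n/2⌋+⌈n/2⌉≡n n) ⟩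
  4 * n ^ n                ∎
  where
    open ≤-Reasoning
    a b : ℕ
    a = ⌊ n /2⌋
    b = ⌈ n /2⌉
    2b≤1+n : 2 * b ≤ suc n
    2b≤1+n = 2*⌈n/2⌉≤1+n n
    2a≤1+n : 2 * a ≤ suc n
    2a≤1+n = ≤-trans (*-monoʳ-≤ 2 (⌊n/2⌋≤⌈n/2⌉ n)) 2b≤1+n

n^n≤4^n*n! : ∀ n → n ^ n ≤ 4 ^ n * n !
n^n≤4^n*n! zero    = ≤-refl
n^n≤4^n*n! (suc n) = begin
  suc n * suc n ^ n            ≤⟨ *-monoʳ-≤ (suc n) ([1+n]^n≤4*n^n n) ⟩
  suc n * (4 * n ^ n)          ≤⟨ *-monoʳ-≤ (suc n) (*-monoʳ-≤ 4 (n^n≤4^n*n! n)) ⟩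
  suc n * (4 * (4 ^ n * n !))  ≡⟨ regroup (suc n) (4 ^ n) (n !) ⟩
  4 * 4 ^ n * (suc n * n !)    ∎
  where
    open ≤-Reasoning
    regroup : ∀ s p f → s * (4 * (p * f)) ≡ 4 * p * (s * f)
    regroup = solve-∀

m^[x+2e]≡m^x*[m*m]^e : ∀ m x e → m ^ (x + 2 * e) ≡ m ^ x * (m * m) ^ e
m^[x+2e]≡m^x*[m*m]^e m x e = begin
  m ^ (x + 2 * e)      ≡⟨ ^-distribˡ-+-* m x (2 * e) ⟩
  m ^ x * m ^ (2 * e)  ≡⟨ cong (m ^ x *_) (^-*-assoc m 2 e) ⟨
  m ^ x * (m ^ 2) ^ e  ≡⟨ cong (λ y → m ^ x * (m * y) ^ e) (*-identityʳ m) ⟩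
  m ^ x * (m * m) ^ e  ∎
  where open ≡-Reasoning

4^x*16^e≤[x+2e]^x*e^e : ∀ x e → 88 ≤ x + 2 * e → 4 ^ x * 16 ^ e ≤ (x + 2 * e) ^ x * e ^ e
4^x*16^e≤[x+2e]^x*e^e x e 88≤k with 16 ≤? e
... | yes 16≤e = *-mono-≤ (^-monoˡ-≤ x (≤-trans (m≤m+n 4 84) 88≤k)) (^-monoˡ-≤ e 16≤e)
... | no  16≰e = begin
  4 ^ x * 16 ^ e  ≤⟨ *-monoʳ-≤ (4 ^ x) (^-monoʳ-≤ 16 e≤15) ⟩
  4 ^ x * 4 ^ 30  ≤⟨ *-monoʳ-≤ (4 ^ x) (^-monoʳ-≤ 4 30≤x) ⟩
  4 ^ x * 4 ^ x   ≡⟨ [m*n]^o≡m^o*n^o 4 4 x ⟨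
  16 ^ x          ≤⟨ ^-monoˡ-≤ x (≤-trans (m≤m+n 16 72) 88≤k) ⟩
  k ^ x           ≤⟨ m≤m*n (k ^ x) (e ^ e) ⟩
  k ^ x * e ^ e   ∎
  where
    open ≤-Reasoning
    k : ℕ
    k = x + 2 * e
    instance _ = n^n≢0 e
    e≤15 : e ≤ 15
    e≤15 = s≤s⁻¹ (≰⇒> 16≰e)
    30≤x : 30 ≤ x
    30≤x = ≤-trans (m≤m+n 30 28) (+-cancelʳ-≤ 30 58 x (≤-trans 88≤k (+-monoʳ-≤ x (*-monoʳ-≤ 2 e≤15))))

4^k*[k*k]^e≤k^k*e^e : ∀ k e → 88 ≤ k → 2 * e ≤ k → 4 ^ k * (k * k) ^ e ≤ k ^ k * e ^ e
4^k*[k*k]^e≤k^k*e^e k e 88≤k 2e≤k = subst Bound (m∸n+n≡m 2e≤k) (bound-at-x+2e (k ∸ 2 * e) 88≤x+2e)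
  where
    Bound : ℕ → Set
    Bound k = 4 ^ k * (k * k) ^ e ≤ k ^ k * e ^ e
    88≤x+2e : 88 ≤ (k ∸ 2 * e) + 2 * e
    88≤x+2e = subst (88 ≤_) (sym (m∸n+n≡m 2e≤k)) 88≤k
    bound-at-x+2e : ∀ x → 88 ≤ x + 2 * e → Bound (x + 2 * e)
    bound-at-x+2e x 88≤k′ = begin
      4 ^ (x + 2 * e) * (k′ * k′) ^ e  ≡⟨ cong (_* (k′ * k′) ^ e) (m^[x+2e]≡m^x*[m*m]^e 4 x e) ⟩
      4 ^ x * 16 ^ e * (k′ * k′) ^ e   ≤⟨ *-monoˡ-≤ ((k′ * k′) ^ e) (4^x*16^e≤[x+2e]^x*e^e x e 88≤k′) ⟩
      k′ ^ x * e ^ e * (k′ * k′) ^ e   ≡⟨ xy∙z≈xz∙y (k′ ^ x) (e ^ e) ((k′ * k′) ^ e) ⟩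
      k′ ^ x * (k′ * k′) ^ e * e ^ e   ≡⟨ cong (_* e ^ e) (m^[x+2e]≡m^x*[m*m]^e k′ x e) ⟨
      k′ ^ k′ * e ^ e                  ∎
      where
        open ≤-Reasoning
        k′ : ℕ
        k′ = x + 2 * e

n^e≤k! : ∀ n k e → 88 ≤ k → 2 * k ≤ n → n * e ≤ k * k → n ^ e ≤ k !
n^e≤k! n k e 88≤k 2k≤n ne≤kk = *-cancelˡ-≤ (4 ^ k * e ^ e) (begin
  4 ^ k * e ^ e * n ^ e    ≡⟨ xy∙z≈x∙zy (4 ^ k) (e ^ e) (n ^ e) ⟩
  4 ^ k * (n ^ e * e ^ e)  ≡⟨ cong (4 ^ k *_) ([m*n]^o≡m^o*n^o n e e) ⟨
  4 ^ k * (n * e) ^ e      ≤⟨ *-monoʳ-≤ (4 ^ k) (^-monoˡ-≤ e ne≤kk) ⟩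
  4 ^ k * (k * k) ^ e      ≤⟨ 4^k*[k*k]^e≤k^k*e^e k e 88≤k 2e≤k ⟩
  k ^ k * e ^ e            ≤⟨ *-monoˡ-≤ (e ^ e) (n^n≤4^n*n! k) ⟩
  4 ^ k * k ! * e ^ e      ≡⟨ xy∙z≈xz∙y (4 ^ k) (k !) (e ^ e) ⟩
  4 ^ k * e ^ e * k !      ∎)
  where
    open ≤-Reasoning
    instance
      _ = >-nonZero (≤-trans (m≤m+n 1 87) 88≤k)
      _ = m^n≢0 4 k
      _ = n^n≢0 e
      _ = m*n≢0 (4 ^ k) (e ^ e)
    2e≤k : 2 * e ≤ k
    2e≤k = *-cancelˡ-≤ k (begin
      k * (2 * e)  ≡⟨ x∙yz≈yx∙z k 2 e ⟩
      2 * k * e    ≤⟨ *-monoˡ-≤ e 2k≤n ⟩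
      n * e        ≤⟨ ne≤kk ⟩
      k * k        ∎)

nCk≤n^h : ∀ {n} k h → 0 < n → 88 ≤ h → 2 * k ≤ n → n * (k ∸ h) ≤ k * k → n C k ≤ n ^ h
nCk≤n^h {n} k h 0<n 88≤h 2k≤n sq =
  ≮⇒≥ λ n^h<nCk → <⇒≱ (n^h<nCk⇒k!<n^[k∸h] h k 0<n n^h<nCk) n^[k∸h]≤k!
  where
    n^[k∸h]≤k! : n ^ (k ∸ h) ≤ k !
    n^[k∸h]≤k! with h ≤? k
    ... | yes h≤k = n^e≤k! n k (k ∸ h) (≤-trans 88≤h h≤k) 2k≤n sq
    ... | no  h≰k rewrite m≤n⇒m∸n≡0 (<⇒≤ (≰⇒> h≰k)) = 1≤n! k

difference-of-squares : ∀ {m g} → m ≤ g → (m + g) * (g ∸ m) + m * m ≡ g * g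
difference-of-squares {m} {g} m≤g =
  subst (λ x → (m + x) * (g ∸ m) + m * m ≡ x * x) (m∸n+n≡m m≤g) (identity m (g ∸ m))
  where
    identity : ∀ m d → (m + (d + m)) * d + m * m ≡ (d + m) * (d + m)
    identity = solve-∀

complement-square-bound : ∀ m g h → m ≤ g → (m + g) * (g ∸ h) ≤ g * g → (m + g) * (m ∸ h) ≤ m * m
complement-square-bound m g h m≤g sq with h ≤? m
... | no  h≰m rewrite m≤n⇒m∸n≡0 (<⇒≤ (≰⇒> h≰m)) | *-zeroʳ (m + g) = z≤n
... | yes h≤m = +-cancelʳ-≤ (g * g) _ _ (begin
  (m + g) * (m ∸ h) + g * g                           ≡⟨ cong ((m + g) * (m ∸ h) +_) (difference-of-squares m≤g) ⟨
  (m + g) * (m ∸ h) + ((m + g) * (g ∸ m) + m * m)     ≡⟨ +-assoc ((m + g) * (m ∸ h)) _ (m * m) ⟨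
  (m + g) * (m ∸ h) + (m + g) * (g ∸ m) + m * m       ≡⟨ cong (_+ m * m) (*-distribˡ-+ (m + g) (m ∸ h) (g ∸ m)) ⟨
  (m + g) * ((m ∸ h) + (g ∸ m)) + m * m               ≡⟨ cong (λ d → (m + g) * d + m * m) [m∸h]+[g∸m]≡g∸h ⟩
  (m + g) * (g ∸ h) + m * m                           ≤⟨ +-monoˡ-≤ (m * m) sq ⟩
  g * g + m * m                                       ≡⟨ +-comm (g * g) (m * m) ⟩
  m * m + g * g                                       ∎)
  where
    open ≤-Reasoning
    [m∸h]+[g∸m]≡g∸h : (m ∸ h) + (g ∸ m) ≡ g ∸ h
    [m∸h]+[g∸m]≡g∸h = begin-equality
      (m ∸ h) + (g ∸ m)  ≡⟨ +-comm (m ∸ h) (g ∸ m) ⟩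
      (g ∸ m) + (m ∸ h)  ≡⟨ +-∸-assoc (g ∸ m) h≤m ⟨
      (g ∸ m) + m ∸ h    ≡⟨ cong (_∸ h) (m∸n+n≡m m≤g) ⟩
      g ∸ h              ∎

2*m≤m+n : ∀ {m n} → m ≤ n → 2 * m ≤ m + n
2*m≤m+n {m} m≤n = +-monoʳ-≤ m (≤-trans (≤-reflexive (+-identityʳ m)) m≤n)

mainTheorem5 : (n g h : ℕ) → 0 < n → 0 < g → 0 < h → h ≤ g →
    n C g > n ^ h →
    g * g > n * (g ∸ h) →
    h < 88
mainTheorem5 n g h 0<n _ _ _ n^h<nCg n[g∸h]<gg = ≰⇒> λ 88≤h → <⇒≱ n^h<nCg (nCg≤n^h 88≤h)
  where
    nCg≤n^h : 88 ≤ h → n C g ≤ n ^ h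
    nCg≤n^h 88≤h with g ≤? n | g ≤? n ∸ g
    ... | no  g≰n | _         rewrite k>n⇒nCk≡0 (≰⇒> g≰n) = z≤n
    ... | yes g≤n | yes g≤n∸g = nCk≤n^h g h 0<n 88≤h (subst (2 * g ≤_) (m+[n∸m]≡n g≤n) (2*m≤m+n g≤n∸g)) (<⇒≤ n[g∸h]<gg)
    ... | yes g≤n | no  g≰n∸g = begin
      n C g  ≡⟨ nCk≡nC[n∸k] g≤n ⟩
      n C m  ≤⟨ nCk≤n^h m h 0<n 88≤h (subst (2 * m ≤_) m+g≡n (2*m≤m+n m≤g)) n[m∸h]≤mm ⟩
      n ^ h  ∎
      where
        open ≤-Reasoning
        m : ℕ
        m = n ∸ g
        m≤g : m ≤ g
        m≤g = <⇒≤ (≰⇒> g≰n∸g)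
        m+g≡n : m + g ≡ n
        m+g≡n = m∸n+n≡m g≤n
        n[m∸h]≤mm : n * (m ∸ h) ≤ m * m
        n[m∸h]≤mm = subst (λ n → n * (m ∸ h) ≤ m * m) m+g≡n
          (complement-square-bound m g h m≤g (subst (λ n → n * (g ∸ h) ≤ g * g) (sym m+g≡n) (<⇒≤ n[g∸h]<gg)))
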